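{- Let $\mathcal{A}$ be a progressive timed MSR (PTS), let $\mathcal{S}_0$ be an initial configuration, and let $m$ be the number of facts in $\mathcal{S}_0$. Let $\mathcal{P}$ be any trace of $\mathcal{A}$ starting from $\mathcal{S}_0$, and consider any segment of $\mathcal{P}$ that begins with an application of the Tick rule, ends with an application of the Tick rule, and contains no other application of the Tick rule; let $k$ be the number of applications of instantaneous rules in this segment (in the paper's notation $\mathcal{S}_i \to_{Tick}\to \mathcal{S}_{i+1}\to\cdots\to\mathcal{S}_j\to_{Tick}\to\mathcal{S}_{j+1}$, $k=j-i$). Then $k<m$.
   Context: Fix a finite first-order typed alphabet $\Sigma$. A timestamped fact is $F@t$ where $F$ is a fact (atomic formula over $\Sigma$) and $t\in\mathbb{N}$. There is a special nullary predicate $Time$. A configuration is a finite multiset of ground timestamped facts containing exactly one fact $Time@t$; $t$ is the global time. The Tick rule is $Time@T \to Time@(T+1)$: it increases the global time by one and leaves all other facts unchanged. An instantaneous rule has the form $Time@T, \mathcal{W}, F_1@T_1', \ldots, F_n@T_n' \mid \mathcal{C} \to Time@T, \mathcal{W}, Q_1@(T+D_1), \ldots, Q_m@(T+D_m)$, with $D_j\in\mathbb{N}$, $\mathcal{W}$ a multiset of timestamped facts possibly with variables, consumed facts $F_i@T_i'$, created facts $Q_j@(T+D_j)$, and guard $\mathcal{C}$ a finite set of constraints $T_a > T_b \pm N$ or $T_a = T_b \pm N$ ($T_a,T_b$ time variables of the precondition, $N\in\mathbb{N}$); $T_a\ge T_b\pm N$ abbreviates the disjunction. A rule with precondition $W$,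 guard $\mathcal{C}$, postcondition $W'$ applies to $\mathcal{S}$ if there is a ground substitution $\sigma$ with $W\sigma\subseteq\mathcal{S}$ (multisets) and $\mathcal{C}\sigma$ true; the result is $(\mathcal{S}\setminus W\sigma)\cup W'\sigma$. A timed MSR is a set of rules consisting of the Tick rule and instantaneous rules; a trace from $\mathcal{S}_0$ is a sequence $\mathcal{S}_0\to\mathcal{S}_1\to\cdots$ of rule applications. A timed MSR is progressive (a PTS) if every instantaneous rule satisfies: $n=m$ (balanced); at least one $D_j\ge 1$; and the guard $\mathcal{C}$ contains $T\ge T_i'$ for every consumed fact $F_i@T_i'$. -}

module Defs where

open import Data.Nat using (ℕ; zero; suc; _+_; _<_; _≤_)
open import Data.Fin using (Fin)
open import Data.List using (List; []; _∷_; _++_; map; length)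
open import Data.List.Membership.Propositional using (_∈_)
open import Data.List.Relation.Unary.All using (All)
open import Data.List.Relation.Unary.Any using (Any)
open import Data.List.Relation.Binary.Permutation.Propositional using (_↭_)
open import Data.Product using (Σ; _×_; _,_; proj₁; proj₂)
open import Data.Sum using (_⊎_)
open import Data.Unit using (⊤)
open import Data.Empty using (⊥)
open import Relation.Binary.PropositionalEquality using (_≡_; _≢_)
open import Relation.Nullary using (¬_)

record Alphabet : Set where
  field
    nSort nFun nPred : ℕ
    dom   : Fin nFun → List (Fin nSort)
    cod   : Fin nFun → Fin nSort
    arity : Fin nPred → List (Fin nSort)

-- Signs for constraints  T_a > T_b ± N,  T_a = T_b ± N
data Sign : Set where
  plus minus : Sign

data Constraint (V : Set) : Set where
  gt eq ge : V → V → Sign → ℕ → Constraint V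

-- the two sides of  T_a ⋈ T_b ± N  as natural numbers
lhs rhs : ℕ → ℕ → Sign → ℕ → ℕ
lhs a b plus  N = a
lhs a b minus N = a + N
rhs a b plus  N = b + N
rhs a b minus N = b

⟦_⟧C : {V : Set} → Constraint V → (V → ℕ) → Set
⟦ gt a b s N ⟧C τ = rhs (τ a) (τ b) s N < lhs (τ a) (τ b) s N
⟦ eq a b s N ⟧C τ = lhs (τ a) (τ b) s N ≡ rhs (τ a) (τ b) s N
⟦ ge a b s N ⟧C τ = ⟦ gt a b s N ⟧C τ ⊎ ⟦ eq a b s N ⟧C τ

module _ (Sig : Alphabet) where
  open Alphabet Sig

  Sort : Set
  Sort = Fin nSort

  mutual
    data Term (Γ : List Sort) : Sort → Set where
      var : ∀ {s} → s ∈ Γ → Term Γ s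
      app : (f : Fin nFun) → Args Γ (dom f) → Term Γ (cod f)

    data Args (Γ : List Sort) : List Sort → Set where
      []  : Args Γ []
      _∷_ : ∀ {s ss} → Term Γ s → Args Γ ss → Args Γ (s ∷ ss)

  data Fact (Γ : List Sort) : Set where
    Time : Fact Γ
    atom : (p : Fin nPred) → Args Γ (arity p) → Fact Γ

  Subst : List Sort → Set
  Subst Γ = (s : Sort) → s ∈ Γ → Term [] s

  mutual
    substT : ∀ {Γ s} → Subst Γ → Term Γ s → Term [] s
    substT σ (var {s} x) = σ s x
    substT σ (app f as) = app f (substA σ as)

    substA : ∀ {Γ ss} → Subst Γ → Args Γ ss → Args [] ss
    substA σ []       = []
    substA σ (t ∷ ts) = substT σ t ∷ substA σ ts

  substF : ∀ {Γ} → Subst Γ → Fact Γ → Fact []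
  substF σ Time       = Time
  substF σ (atom p as) = atom p (substA σ as)

  TFact : Set
  TFact = Fact [] × ℕ

  -- finite multisets of ground timestamped facts, as lists up to permutation
  MSet : Set
  MSet = List TFact

  IsConfig : MSet → Set
  IsConfig S = Σ ℕ λ t → Σ MSet λ R →
    (S ↭ ((Time , t) ∷ R)) × All (λ x → proj₁ x ≢ Time) R

  -- an instantaneous rule
  --   Time@T, W, F_1@T_1', …, F_n@T_n' | C → Time@T, W, Q_1@(T+D_1), …, Q_m@(T+D_m)
  record Rule : Set where
    field
      Γ        : List Sort
      nTV      : ℕ
      T        : Fin nTV
      W        : List (Fact Γ × Fin nTV)
      consumed : List (Fact Γ × Fin nTV)
      created  : List (Fact Γ × ℕ)
      guard    : List (Constraint (Fin nTV))

  module _ (r : Rule) where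
    open Rule r

    pre : Subst Γ → (Fin nTV → ℕ) → MSet
    pre σ τ = (Time , τ T) ∷ (map (λ x → substF σ (proj₁ x) , τ (proj₂ x)) W
                              ++ map (λ x → substF σ (proj₁ x) , τ (proj₂ x)) consumed)

    post : Subst Γ → (Fin nTV → ℕ) → MSet
    post σ τ = (Time , τ T) ∷ (map (λ x → substF σ (proj₁ x) , τ (proj₂ x)) W
                               ++ map (λ x → substF σ (proj₁ x) , τ T + proj₂ x) created)

    RuleApp : MSet → MSet → Set
    RuleApp S S' = Σ (Subst Γ) λ σ → Σ (Fin nTV → ℕ) λ τ →
      All (λ c → ⟦ c ⟧C τ) guard ×
      Σ MSet λ R → (S ↭ (pre σ τ ++ R)) × (S' ↭ (post σ τ ++ R))

    IsProgressive : Set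
    IsProgressive =
      (length consumed ≡ length created) ×
      Any (λ q → 1 ≤ proj₂ q) created ×
      All (λ c → Σ Sign λ sg → ge T (proj₂ c) sg 0 ∈ guard) consumed

  TickApp : MSet → MSet → Set
  TickApp S S' = Σ ℕ λ t → Σ MSet λ R → (S ↭ ((Time , t) ∷ R)) × (S' ↭ ((Time , suc t) ∷ R))

  -- a timed MSR: the Tick rule together with a set of instantaneous rules
  TMSR : Set₁
  TMSR = Rule → Set

  IsPTS : TMSR → Set
  IsPTS A = (r : Rule) → A r → IsProgressive r

  data Step (A : TMSR) (S S' : MSet) : Set where
    tick : TickApp S S' → Step A S S'
    inst : (r : Rule) → A r → RuleApp r S S' → Step A S S'

  IsTick : ∀ {A S S'} → Step A S S' → Set
  IsTick (tick _)     = ⊤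
  IsTick (inst _ _ _) = ⊥

  -- a (finite prefix of a) trace S_0 → S_1 → ⋯ → S_len of configurations
  record Trace (A : TMSR) (S₀ : MSet) : Set where
    field
      len     : ℕ
      state   : ℕ → MSet
      start   : state 0 ≡ S₀
      step    : (i : ℕ) → i < len → Step A (state i) (state (suc i))
      configs : (i : ℕ) → i ≤ len → IsConfig (state i)

  TickAt : ∀ {A S₀} → Trace A S₀ → ℕ → Set
  TickAt P i = (p : i < Trace.len P) → IsTick (Trace.step P i p)

  InstAt : ∀ {A S₀} → Trace A S₀ → ℕ → Set
  InstAt P i = (p : i < Trace.len P) → ¬ IsTick (Trace.step P i p)

-- Fix the global time t reached after the first Tick; instantaneous rules
-- keep Time@t.  Count the facts of a configuration whose timestamp is at
-- most t.  A progressive rule applied at time t consumes only facts with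
-- timestamp ≤ t and, being balanced, creates equally many facts, at least
-- one of them strictly in the future; so every instantaneous step lowers the
-- count by at least one.  The count is at most the (invariant) number m of
-- facts and is still ≥ 1 at the second Tick because Time@t is counted, so at
-- most m − 1 instantaneous steps fit between the two Ticks.
module Submission where

open import Defs
open import Data.Nat using (ℕ; _<_; _∸_; suc; zero; _+_; _≤_; _≤?_)
open import Data.Nat.Properties
open import Data.Fin using (Fin)
open import Data.List using (List; _∷_; _++_; map; length; filter)
open import Data.List.Properties using (length-++; length-map; length-filter; filter-all; filter-notAll; filter-some; filter-++)
open import Data.List.Membership.Propositional using (_∈_)
open import Data.List.Relation.Unary.All as All using (All)
open import Data.List.Relation.Unary.All.Properties as All using ()
open import Data.List.Relation.Unary.Any as Any using (Any; here; there)
open import Data.List.Relation.Unary.Any.Properties as Any using ()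
open import Data.List.Relation.Binary.Permutation.Propositional using (_↭_; ↭-sym)
open import Data.List.Relation.Binary.Permutation.Propositional.Properties using (∈-resp-↭; ↭-length; filter-↭)
open import Data.Product using (_×_; _,_; proj₁; proj₂)
open import Data.Sum using (inj₁; inj₂)
open import Data.Empty using (⊥-elim)
open import Relation.Nullary using (¬_)
open import Relation.Unary using (Decidable)
open import Relation.Binary.PropositionalEquality

module _ {A : Set} (μ : List A → ℕ)
         (μ-↭ : ∀ {xs ys} → xs ↭ ys → μ xs ≡ μ ys)
         (μ-++ : ∀ xs ys → μ (xs ++ ys) ≡ μ xs + μ ys)
         {S S' ks cs qs R : List A}
         (S↭ : S ↭ (ks ++ cs) ++ R) (S'↭ : S' ↭ (ks ++ qs) ++ R) where

  private
    μ-split : ∀ {T xs} → T ↭ (ks ++ xs) ++ R → μ T ≡ (μ ks + μ xs) + μ R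
    μ-split {T} {xs} T↭ = begin
      μ T                       ≡⟨ μ-↭ T↭ ⟩
      μ ((ks ++ xs) ++ R)       ≡⟨ μ-++ (ks ++ xs) R ⟩
      μ (ks ++ xs) + μ R        ≡⟨ cong (_+ μ R) (μ-++ ks xs) ⟩
      (μ ks + μ xs) + μ R       ∎
      where open ≡-Reasoning

  μ-exchange-≡ : μ cs ≡ μ qs → μ S ≡ μ S'
  μ-exchange-≡ cs≡qs =
    trans (μ-split S↭) (trans (cong (λ x → (μ ks + x) + μ R) cs≡qs) (sym (μ-split S'↭)))

  μ-exchange-< : μ qs < μ cs → μ S' < μ S
  μ-exchange-< lt rewrite μ-split S↭ | μ-split S'↭ =
    +-monoˡ-< (μ R) (+-monoʳ-< (μ ks) lt)

module _ {B : Set} where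

  IsPast : ℕ → B × ℕ → Set
  IsPast t x = proj₂ x ≤ t

  isPast? : ∀ t → Decidable (IsPast t)
  isPast? t x = proj₂ x ≤? t

  countPast : ℕ → List (B × ℕ) → ℕ
  countPast t xs = length (filter (isPast? t) xs)

  countPast-↭ : ∀ t {xs ys} → xs ↭ ys → countPast t xs ≡ countPast t ys
  countPast-↭ t p = ↭-length (filter-↭ (isPast? t) p)

  countPast-++ : ∀ t xs ys → countPast t (xs ++ ys) ≡ countPast t xs + countPast t ys
  countPast-++ t xs ys =
    trans (cong length (filter-++ (isPast? t) xs ys)) (length-++ (filter (isPast? t) xs))

  countPast≤length : ∀ t xs → countPast t xs ≤ length xs
  countPast≤length t = length-filter (isPast? t)

  countPast-all : ∀ t {xs} → All (IsPast t) xs → countPast t xs ≡ length xs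
  countPast-all t ps = cong length (filter-all (isPast? t) ps)

  countPast-future : ∀ t {xs} → Any (λ x → t < proj₂ x) xs → countPast t xs < length xs
  countPast-future t {xs} fs = filter-notAll (isPast? t) xs (Any.map <⇒≱ fs)

  countPast-∈ : ∀ {t b xs} → (b , t) ∈ xs → 0 < countPast t xs
  countPast-∈ {t} m = filter-some (isPast? t) (Any.map (λ { refl → ≤-refl }) m)

ge-zero⇒≤ : ∀ {V : Set} (a b : V) sg (τ : V → ℕ) → ⟦ ge a b sg 0 ⟧C τ → τ b ≤ τ a
ge-zero⇒≤ a b plus  τ (inj₁ b+0<a) = <⇒≤ (subst (_< τ a) (+-identityʳ (τ b)) b+0<a)
ge-zero⇒≤ a b plus  τ (inj₂ a≡b+0) = ≤-reflexive (sym (trans a≡b+0 (+-identityʳ (τ b))))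
ge-zero⇒≤ a b minus τ (inj₁ b<a+0) = <⇒≤ (subst (τ b <_) (+-identityʳ (τ a)) b<a+0)
ge-zero⇒≤ a b minus τ (inj₂ a+0≡b) = ≤-reflexive (trans (sym a+0≡b) (+-identityʳ (τ a)))

module _ (Sig : Alphabet) where

  config-Time∈ : ∀ {S} (c : IsConfig Sig S) → (Time , proj₁ c) ∈ S
  config-Time∈ (_ , _ , S↭ , _) = ∈-resp-↭ (↭-sym S↭) (here refl)

  config-time-unique : ∀ {S} → IsConfig Sig S → ∀ {u v} → (Time , u) ∈ S → (Time , v) ∈ S → u ≡ v
  config-time-unique {S} (t , R , S↭ , noTime) mu mv = trans (is-t mu) (sym (is-t mv))
    where
    is-t : ∀ {w} → (Time , w) ∈ S → w ≡ t
    is-t m with ∈-resp-↭ S↭ m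
    ... | here refl = refl
    ... | there m'  = ⊥-elim (All.lookup noTime m' refl)

  module _ (r : Rule Sig) where
    open Rule r

    -- pre σ τ and post σ τ are definitionally keptInst σ τ ++ consumedInst σ τ
    -- and keptInst σ τ ++ createdInst σ τ.
    keptInst : Subst Sig Γ → (Fin nTV → ℕ) → MSet Sig
    keptInst σ τ = (Time , τ T) ∷ map (λ x → substF Sig σ (proj₁ x) , τ (proj₂ x)) W

    consumedInst : Subst Sig Γ → (Fin nTV → ℕ) → MSet Sig
    consumedInst σ τ = map (λ x → substF Sig σ (proj₁ x) , τ (proj₂ x)) consumed

    createdInst : Subst Sig Γ → (Fin nTV → ℕ) → MSet Sig
    createdInst σ τ = map (λ x → substF Sig σ (proj₁ x) , τ T + proj₂ x) created

    consumedInst-past : IsProgressive Sig r → ∀ σ τ → All (λ c → ⟦ c ⟧C τ) guard →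
      All (IsPast (τ T)) (consumedInst σ τ)
    consumedInst-past (_ , _ , guarded) σ τ holds =
      All.map⁺ (All.map (λ { (sg , c∈) → ge-zero⇒≤ T _ sg τ (All.lookup holds c∈) }) guarded)

    createdInst-future : IsProgressive Sig r → ∀ σ τ → Any (λ x → τ T < proj₂ x) (createdInst σ τ)
    createdInst-future (_ , delayed , _) σ τ =
      Any.map⁺ (Any.map (m<m+n (τ T)) delayed)

    length-consumedInst : IsProgressive Sig r → ∀ σ τ → length (consumedInst σ τ) ≡ length (createdInst σ τ)
    length-consumedInst (balanced , _ , _) σ τ =
      trans (length-map _ consumed) (trans balanced (sym (length-map _ created)))

    ruleTime : ∀ {S S'} → RuleApp Sig r S S' → ℕ
    ruleTime (σ , τ , _) = τ T

    RuleApp-Time∈pre : ∀ {S S'} (ρ : RuleApp Sig r S S') → (Time , ruleTime ρ) ∈ S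
    RuleApp-Time∈pre (_ , _ , _ , _ , S↭ , _) = ∈-resp-↭ (↭-sym S↭) (here refl)

    RuleApp-Time∈post : ∀ {S S'} (ρ : RuleApp Sig r S S') → (Time , ruleTime ρ) ∈ S'
    RuleApp-Time∈post (_ , _ , _ , _ , _ , S'↭) = ∈-resp-↭ (↭-sym S'↭) (here refl)

    RuleApp-length : IsProgressive Sig r → ∀ {S S'} → RuleApp Sig r S S' → length S ≡ length S'
    RuleApp-length prog (σ , τ , _ , R , S↭ , S'↭) =
      μ-exchange-≡ length ↭-length (λ xs ys → length-++ xs)
        {ks = keptInst σ τ} {consumedInst σ τ} {createdInst σ τ} {R} S↭ S'↭ (length-consumedInst prog σ τ)

    RuleApp-countPast-< : IsProgressive Sig r → ∀ {S S'} (ρ : RuleApp Sig r S S') →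
      countPast (ruleTime ρ) S' < countPast (ruleTime ρ) S
    RuleApp-countPast-< prog (σ , τ , holds , R , S↭ , S'↭) =
      μ-exchange-< (countPast u) (countPast-↭ u) (countPast-++ u)
        {ks = keptInst σ τ} {consumedInst σ τ} {createdInst σ τ} {R} S↭ S'↭ (begin-strict
        countPast u (createdInst σ τ)   <⟨ countPast-future u (createdInst-future prog σ τ) ⟩
        length (createdInst σ τ)        ≡⟨ sym (length-consumedInst prog σ τ) ⟩
        length (consumedInst σ τ)       ≡⟨ sym (countPast-all u (consumedInst-past prog σ τ holds)) ⟩
        countPast u (consumedInst σ τ)  ∎)
      where
      u = τ T
      open ≤-Reasoning

  module _ {A : TMSR Sig} (pts : IsPTS Sig A) where

    Step-length : ∀ {S S'} → Step Sig A S S' → length S ≡ length S'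
    Step-length (tick (_ , _ , S↭ , S'↭)) = trans (↭-length S↭) (sym (↭-length S'↭))
    Step-length (inst r r∈A ρ)           = RuleApp-length r (pts r r∈A) ρ

    instStep-countPast-< : ∀ {S S' t} (s : Step Sig A S S') → ¬ IsTick Sig s →
      IsConfig Sig S' → (Time , t) ∈ S' → (Time , t) ∈ S × countPast t S' < countPast t S
    instStep-countPast-< (tick _) notTick _ _ = ⊥-elim (notTick _)
    instStep-countPast-< (inst r r∈A ρ) _ c' t∈S'
      with config-time-unique c' (RuleApp-Time∈post r ρ) t∈S'
    ... | refl = RuleApp-Time∈pre r ρ , RuleApp-countPast-< r (pts r r∈A) ρ

    module _ {S₀ : MSet Sig} (P : Trace Sig A S₀) where
      open Trace P

      length-state : ∀ l → l ≤ len → length (state l) ≡ length S₀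
      length-state zero    _     = cong length start
      length-state (suc l) l<len = trans (sym (Step-length (step l l<len))) (length-state l (<⇒≤ l<len))

      countPast-run : ∀ d a {t} → d + a ≤ len → (∀ l → a ≤ l → l < d + a → InstAt Sig P l) →
        (Time , t) ∈ state (d + a) → d + countPast t (state (d + a)) ≤ countPast t (state a)
      countPast-run zero    a _       _     _  = ≤-refl
      countPast-run (suc d) a {t} d+a<len insts t∈ = begin
        suc d + countPast t (state (suc d + a))    ≡⟨ sym (+-suc d _) ⟩
        d + suc (countPast t (state (suc d + a)))  ≤⟨ +-monoʳ-≤ d (proj₂ lastStep) ⟩
        d + countPast t (state (d + a))            ≤⟨ countPast-run d a (<⇒≤ d+a<len) earlier (proj₁ lastStep) ⟩
        countPast t (state a)                      ∎
        where
        open ≤-Reasoning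
        lastStep : (Time , t) ∈ state (d + a) × countPast t (state (suc d + a)) < countPast t (state (d + a))
        lastStep = instStep-countPast-< (step (d + a) d+a<len) (insts (d + a) (m≤n+m a d) ≤-refl d+a<len)
                                        (configs (suc d + a) d+a<len) t∈
        earlier : ∀ l → a ≤ l → l < d + a → InstAt Sig P l
        earlier l a≤l l<d+a = insts l a≤l (m<n⇒m<1+n l<d+a)

      instantaneous-run-bound : ∀ d a → d + a ≤ len → (∀ l → a ≤ l → l < d + a → InstAt Sig P l) →
        d < length S₀
      instantaneous-run-bound d a d+a≤len insts = begin-strict
        d                                <⟨ m<m+n d (countPast-∈ (config-Time∈ c)) ⟩
        d + countPast t (state (d + a))  ≤⟨ countPast-run d a d+a≤len insts (config-Time∈ c) ⟩
        countPast t (state a)            ≤⟨ countPast≤length t (state a) ⟩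
        length (state a)                 ≡⟨ length-state a (≤-trans (m≤n+m a d) d+a≤len) ⟩
        length S₀                        ∎
        where
        open ≤-Reasoning
        c : IsConfig Sig (state (d + a))
        c = configs (d + a) d+a≤len
        t : ℕ
        t = proj₁ c

-- The two Ticks only delimit the segment; the bound holds for any run of
-- instantaneous steps.
proposition2 : (Sig : Alphabet) (A : TMSR Sig) → IsPTS Sig A →
    (S₀ : MSet Sig) → IsConfig Sig S₀ → (P : Trace Sig A S₀) →
    (i j : ℕ) → i < j → j < Trace.len P →
    TickAt Sig P i → TickAt Sig P j →
    ((l : ℕ) → i < l → l < j → InstAt Sig P l) →
    j ∸ suc i < length S₀
proposition2 Sig A pts S₀ _ P i j i<j j<len _ _ between with j ∸ suc i | m∸n+n≡m i<j
... | k | refl = instantaneous-run-bound Sig pts P k (suc i) (<⇒≤ j<len) between
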